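{- Let $G$ be a connected graph and let $A, B$ be two disjoint, linked and saturated subsets of $V(G)$ such that $N(A\cup B)$ is not a clique. Then for every collection $\mathcal{X}$ of equivalence classes of $\equiv_{AB}$, if $\left(\bigcup\mathcal{X}\right)\cap N(A\cup B)$ is a clique, then both $A\cup\bigcup\mathcal{X}$ and $B\cup\bigcup\mathcal{X}$ are convex.
   Context: All graphs are finite, undirected and loopless. For $X\subseteq V(G)$, $N(X)=\{u\in V(G)\setminus X : u\text{ adjacent to some }x\in X\}$, $N[X]=N(X)\cup X$, and $G-X$ is the subgraph induced by $V(G)\setminus X$. A chordless $uv$-path is a $uv$-path that is an induced subgraph. A set $C$ is convex (monophonically convex) if for all $u,v\in C$ every vertex on a chordless $uv$-path lies in $C$; $\mathrm{cl}(X)$ is the intersection of all convex sets containing $X$. $A,B$ are linked if some vertex of $A$ is adjacent to some vertex of $B$. $A/B=\{v : \mathrm{cl}(B\cup\{v\})\cap A\ne\emptyset\}$. A set $Z\subseteq V(G)\setminus(A\cup B)$ is forbidden if $\mathrm{cl}(Z)$ meets both $A$ and $B$; $\mathrm{mfs}(A,B)$ is the family of inclusion-minimal forbidden sets. $\sigma(A,B)=\mathrm{cl}\big(A/B\cup\bigcup\{\bigcap_{z\in Z}\mathrm{cl}(A\cup\{z\}) : Z\in\mathrm{mfs}(A,B)\}\big)$; $S(A,B)=\bigcup_{i\ge0}\sigma(A_i,B_i)$ with $A_0=A$, $B_0=B$, $A_i=\sigma(A_{i-1},B_{i-1})$, $B_i=\sigma(B_{i-1},A_{i-1})$; $A,B$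 are saturated if $A=S(A,B)$ and $B=S(B,A)$. An intersecting sequence is a sequence $S_1,\dots,S_k$ of (not necessarily distinct) connected components of $G-N[A\cup B]$ with $N(S_i)\cap N(S_{i+1})\ne\emptyset$ for $1\le i<k$; vertices $u,v$ belong to it if $u\in N[S_i]$ and $v\in N[S_j]$ for some $i,j$. On $V(G)\setminus(A\cup B)$, $u\equiv_{AB}v$ iff $u=v$ or $u,v$ belong to a common intersecting sequence; this is an equivalence relation whose classes are denoted $[v]_{AB}$. -}

module Defs where

open import Level using (0ℓ)
open import Data.Bool using (Bool; T)
open import Data.Nat using (ℕ; suc)
open import Data.Fin using (Fin; zero; suc; toℕ; fromℕ; inject₁)
open import Data.Fin.Subset using (Subset; _∈_)
open import Data.List using (List)
open import Data.List.Relation.Unary.Any using (Any)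
open import Data.List.Relation.Unary.All using (All)
open import Data.Product using (Σ; ∃; _×_; _,_)
open import Data.Sum using (_⊎_)
open import Data.Empty using (⊥)
open import Relation.Nullary using (¬_)
open import Relation.Binary.PropositionalEquality using (_≡_)
open import Function.Bundles using (_⇔_)

record Graph : Set where
  field
    n       : ℕ
    adj     : Fin n → Fin n → Bool
    sym     : ∀ u v → adj u v ≡ adj v u
    irrefl  : ∀ u → ¬ T (adj u u)

-- Vertex sets are predicates on vertices (the "small" sets quantified
-- over, e.g. convex sets or forbidden sets Z, are finite subsets Subset n).
module _ (G : Graph) where
  open Graph G

  V : Set
  V = Fin n

  VSet : Set₁
  VSet = V → Set

  Adj : V → V → Set
  Adj u v = T (adj u v)

  ⟦_⟧ : Subset n → VSet
  ⟦ S ⟧ v = v ∈ S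

  _⊆'_ : VSet → VSet → Set
  X ⊆' Y = ∀ v → X v → Y v

  _∪'_ : VSet → VSet → VSet
  (X ∪' Y) v = X v ⊎ Y v

  _∩'_ : VSet → VSet → VSet
  (X ∩' Y) v = X v × Y v

  ｛_｝ : V → VSet
  ｛ u ｝ v = v ≡ u

  Meets : VSet → VSet → Set
  Meets X Y = ∃ λ v → X v × Y v

  _≐_ : VSet → VSet → Set
  X ≐ Y = ∀ v → X v ⇔ Y v

  N : VSet → VSet
  N X u = ¬ X u × ∃ λ x → X x × Adj u x

  N[_] : VSet → VSet
  N[ X ] = N X ∪' X

  IsWalk : V → V → (k : ℕ) → (Fin (suc k) → V) → Set
  IsWalk u v k p = p zero ≡ u × p (fromℕ k) ≡ v
                 × (∀ (i : Fin k) → Adj (p (inject₁ i)) (p (suc i)))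

  IsChordlessPath : V → V → (k : ℕ) → (Fin (suc k) → V) → Set
  IsChordlessPath u v k p =
    p zero ≡ u × p (fromℕ k) ≡ v
    × (∀ i j → p i ≡ p j → i ≡ j)
    × (∀ i j → Adj (p i) (p j) ⇔ (suc (toℕ i) ≡ toℕ j ⊎ suc (toℕ j) ≡ toℕ i))

  Connected : Set
  Connected = ∀ u v → ∃ λ k → Σ (Fin (suc k) → V) λ p → IsWalk u v k p

  Convex : VSet → Set
  Convex C = ∀ u v → C u → C v → ∀ k (p : Fin (suc k) → V) →
             IsChordlessPath u v k p → ∀ i → C (p i)

  cl : VSet → VSet
  cl X v = ∀ (C : Subset n) → Convex ⟦ C ⟧ → X ⊆' ⟦ C ⟧ → v ∈ C

  Clique : VSet → Set
  Clique K = ∀ u v → K u → K v → ¬ u ≡ v → Adj u v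

  Linked : VSet → VSet → Set
  Linked X Y = ∃ λ x → ∃ λ y → X x × Y y × Adj x y

  Disjoint : VSet → VSet → Set
  Disjoint X Y = ∀ v → X v → Y v → ⊥

  _/_ : VSet → VSet → VSet
  (A / B) v = Meets (cl (B ∪' ｛ v ｝)) A

  Forbidden : VSet → VSet → Subset n → Set
  Forbidden A B Z = (∀ z → z ∈ Z → ¬ (A ∪' B) z)
                  × Meets (cl ⟦ Z ⟧) A × Meets (cl ⟦ Z ⟧) B

  MFS : VSet → VSet → Subset n → Set
  MFS A B Z = Forbidden A B Z
            × (∀ Z' → Forbidden A B Z' → ⟦ Z' ⟧ ⊆' ⟦ Z ⟧ → ⟦ Z ⟧ ⊆' ⟦ Z' ⟧)

  σ : VSet → VSet → VSet
  σ A B = cl ((A / B) ∪' U)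
    where
    U : VSet
    U v = ∃ λ (Z : Subset n) → MFS A B Z × (∀ z → z ∈ Z → cl (A ∪' ｛ z ｝) v)

  iter : VSet → VSet → ℕ → VSet × VSet
  iter A B ℕ.zero = A , B
  iter A B (suc i) with iter A B i
  ... | Ai , Bi = σ Ai Bi , σ Bi Ai

  S : VSet → VSet → VSet
  S A B v = ∃ λ i → let (Ai , Bi) = iter A B i in σ Ai Bi v

  Saturated : VSet → VSet → Set
  Saturated A B = (A ≐ S A B) × (B ≐ S B A)

  IsComponent : VSet → VSet → Subset n → Set
  IsComponent A B C =
    (∃ λ s → s ∈ C)
    × (∀ s → s ∈ C → ¬ N[ A ∪' B ] s)
    × (∀ s t → s ∈ C → t ∈ C → ∃ λ k → Σ (Fin (suc k) → V) λ p →
         IsWalk s t k p × (∀ i → p i ∈ C))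
    × (∀ s w → s ∈ C → ¬ N[ A ∪' B ] w → Adj s w → w ∈ C)

  IsIntersectingSeq : VSet → VSet → (k : ℕ) → (Fin (suc k) → Subset n) → Set
  IsIntersectingSeq A B k Ss =
    (∀ i → IsComponent A B (Ss i))
    × (∀ (i : Fin k) → Meets (N ⟦ Ss (inject₁ i) ⟧) (N ⟦ Ss (suc i) ⟧))

  BelongsTo : (k : ℕ) → (Fin (suc k) → Subset n) → V → Set
  BelongsTo k Ss u = ∃ λ i → N[ ⟦ Ss i ⟧ ] u

  EquivAB : VSet → VSet → V → V → Set
  EquivAB A B u v = ¬ (A ∪' B) u × ¬ (A ∪' B) v
    × (u ≡ v ⊎ ∃ λ k → Σ (Fin (suc k) → Subset n) λ Ss →
          IsIntersectingSeq A B k Ss × BelongsTo k Ss u × BelongsTo k Ss v)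

  IsClass : VSet → VSet → Subset n → Set
  IsClass A B X = ∃ λ v → ¬ (A ∪' B) v × (∀ u → u ∈ X ⇔ EquivAB A B u v)

  ⋃ : List (Subset n) → VSet
  ⋃ 𝒳 u = Any (λ X → u ∈ X) 𝒳

{-# OPTIONS --safe #-}
module Submission where

-- Write ∂ = N(A ∪ B). Saturation gives σ(A,B) ⊆ A and σ(B,A) ⊆ B, so A and B are convex,
-- A/B ⊆ A and B/A ⊆ B. Hence every vertex of ∂ has neighbours in both A and B, two
-- non-adjacent vertices y, q of ∂ form a minimal forbidden set, whence
-- cl(A ∪ {y}) ∩ cl(A ∪ {q}) ⊆ A, and, as ∂ is not a clique, all vertices of ∂ have the same
-- neighbours in A.
--
-- A decidable set D is convex as soon as no chordless path of length ≥ 2 between vertices of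
-- D has both its second and its penultimate vertex outside D. For D = A ∪ ⋃𝒳, an end of such
-- a path in ⋃𝒳 but not in ∂ is impossible, since a class is closed along the components of
-- G − N[A ∪ B]; two ends in ⋃𝒳 ∩ ∂ are adjacent; two ends in A contradict the convexity of A;
-- and ends a ∈ A, y ∈ ∂ make the vertex next to a a vertex of ∂, so y is adjacent to a.
-- Exchanging A and B gives the second half.

open import Defs
open import Data.Bool using (T)
open import Data.Bool.Properties using (T?)
open import Data.Empty using (⊥; ⊥-elim)
open import Data.Fin as Fin using (Fin; toℕ; fromℕ<)
open import Data.Fin.Properties
  using (_≟_; any?; toℕ-injective; toℕ-fromℕ; toℕ-fromℕ<; toℕ≤pred[n]; injective⇒≤)
open import Data.Fin.Subset using (Subset; _∈_; ⁅_⁆) renaming (_∪_ to _∪ˢ_)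
open import Data.Fin.Subset.Properties using (_∈?_; x∈⁅x⁆; x∈⁅y⁆⇒x≡y; x∈p∪q⁻; x∈p∪q⁺)
open import Data.List using (List)
open import Data.List.Membership.Propositional using (find; lose)
open import Data.List.Relation.Unary.All as All using (All)
open import Data.List.Relation.Unary.Any as Any using (Any)
open import Data.Nat using (ℕ; zero; suc; _+_; _≤_; _<_; z≤n; s≤s; s≤s⁻¹)
open import Data.Nat.Properties using (≤-refl; <⇒≤; suc-injective; m≤n⇒m≤1+n; m<n⇒m<1+n)
open import Data.Product using (Σ; ∃; ∃₂; _×_; _,_; proj₁; proj₂; map₂)
open import Data.Sum as Sum using (_⊎_; inj₁; inj₂; [_,_]′)
open import Data.Unit using (⊤; tt)
open import Data.Vec using (tabulate)
open import Data.Vec.Properties using ([]=⇒lookup; lookup⇒[]=; lookup∘tabulate)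
import Data.Vec.Functional as Vector
open import Function using (_∘_; id)
open import Function.Bundles using (mk⇔; Equivalence)
open import Relation.Binary.Construct.Closure.ReflexiveTransitive as Star
  using (Star; ε; _◅_; _◅◅_)
open import Relation.Binary.PropositionalEquality
  using (_≡_; _≢_; refl; sym; trans; cong; subst; subst₂)
open import Relation.Nullary using (¬_; Dec; yes; no; does)
open import Relation.Nullary.Decidable
  using (toSum; _×-dec_; _⊎-dec_; ¬?; map′; decidable-stable; dec-true)
open import Relation.Unary using (Decidable; _⊆_; _∪_; _∩_)

subset : ∀ {n} {P : Fin n → Set} → Decidable P → Subset n
subset P? = tabulate (does ∘ P?)

∈-subset⁺ : ∀ {n} {P : Fin n → Set} (P? : Decidable P) {x} → P x → x ∈ subset P?
∈-subset⁺ P? {x} px = lookup⇒[]= x _ (trans (lookup∘tabulate _ x) (dec-true (P? x) px))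

∈-subset⁻ : ∀ {n} {P : Fin n → Set} (P? : Decidable P) {x} → x ∈ subset P? → P x
∈-subset⁻ P? {x} x∈ with P? x | trans (sym (lookup∘tabulate _ x)) ([]=⇒lookup x∈)
... | yes px | _ = px
... | no _   | ()

∈⁅⁆∪⁅⁆ : ∀ {n} {w y q : Fin n} → w ∈ ⁅ y ⁆ ∪ˢ ⁅ q ⁆ → w ≡ y ⊎ w ≡ q
∈⁅⁆∪⁅⁆ {y = y} {q} = Sum.map (x∈⁅y⁆⇒x≡y y) (x∈⁅y⁆⇒x≡y q) ∘ x∈p∪q⁻ ⁅ y ⁆ ⁅ q ⁆

module GraphTheory (G : Graph) where

  open Graph G using (n; adj) renaming (sym to adj-sym; irrefl to adj-irrefl)

  private variable
    i j k m t : ℕ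
    u v w x y z d d′ s : V G
    p q : ℕ → V G
    C D P Q W X Y : VSet G

  adj? : ∀ u v → Dec (Adj G u v)
  adj? u v = T? (adj u v)

  Adj-sym : Adj G u v → Adj G v u
  Adj-sym {u} {v} = subst T (adj-sym u v)

  Adj-irrefl : ¬ Adj G u u
  Adj-irrefl {u} = adj-irrefl u

  Adj⇒≢ : Adj G u v → u ≢ v
  Adj⇒≢ a refl = Adj-irrefl a

  -- p 0, …, p k; the values of p beyond k play no role.
  record ChordlessPath (k : ℕ) (p : ℕ → V G) : Set where
    field
      injective : i ≤ k → j ≤ k → p i ≡ p j → i ≡ j
      edge      : i < k → Adj G (p i) (p (suc i))
      chordless : i ≤ k → j ≤ k → Adj G (p i) (p j) → suc i ≡ j ⊎ suc j ≡ i

    consecutive : i ≤ k → j ≤ k → suc i ≡ j ⊎ suc j ≡ i → Adj G (p i) (p j)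
    consecutive _   j≤k (inj₁ refl) = edge j≤k
    consecutive i≤k _   (inj₂ refl) = Adj-sym (edge i≤k)

  open ChordlessPath public

  single : ChordlessPath 0 (λ _ → x)
  single = record
    { injective = λ { z≤n z≤n _ → refl }
    ; edge      = λ ()
    ; chordless = λ _ _ a → ⊥-elim (Adj-irrefl a)
    }

  tail : ChordlessPath (suc k) p → ChordlessPath k (λ t → p (suc t))
  tail c = record
    { injective = λ i≤k j≤k e → suc-injective (injective c (s≤s i≤k) (s≤s j≤k) e)
    ; edge      = λ i<k → edge c (s≤s i<k)
    ; chordless = λ i≤k j≤k a →
        Sum.map suc-injective suc-injective (chordless c (s≤s i≤k) (s≤s j≤k) a)
    }

  init : ChordlessPath (suc k) p → ChordlessPath k p
  init c = record
    { injective = λ i≤k j≤k → injective c (m≤n⇒m≤1+n i≤k) (m≤n⇒m≤1+n j≤k)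
    ; edge      = λ i<k → edge c (m<n⇒m<1+n i<k)
    ; chordless = λ i≤k j≤k → chordless c (m≤n⇒m≤1+n i≤k) (m≤n⇒m≤1+n j≤k)
    }

  infixr 5 _◃_
  _◃_ : V G → (ℕ → V G) → ℕ → V G
  (x ◃ p) zero    = x
  (x ◃ p) (suc t) = p t

  Related : V G → V G → Set
  Related x w = x ≡ w ⊎ Adj G x w

  related? : ∀ x w → Dec (Related x w)
  related? x w = x ≟ w ⊎-dec adj? x w

  cons : Adj G x (p 0) → (∀ {t} → t < k → ¬ Related x (p (suc t))) →
         ChordlessPath k p → ChordlessPath (suc k) (x ◃ p)
  cons {x} {p} {k} x∼p₀ fresh c = record
    { injective = injective′
    ; edge      = edge′
    ; chordless = chordless′
    }
    where
    only-head : j ≤ k → Related x (p j) → j ≡ 0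
    only-head {zero}  _   _ = refl
    only-head {suc j} j<k r = ⊥-elim (fresh j<k r)

    x≢ : j ≤ k → x ≢ p j
    x≢ j≤k e with only-head j≤k (inj₁ e)
    ... | refl = Adj⇒≢ x∼p₀ e

    injective′ : i ≤ suc k → j ≤ suc k → (x ◃ p) i ≡ (x ◃ p) j → i ≡ j
    injective′ {zero}  {zero}  _   _   _ = refl
    injective′ {zero}  {suc j} _   j≤k e = ⊥-elim (x≢ (s≤s⁻¹ j≤k) e)
    injective′ {suc i} {zero}  i≤k _   e = ⊥-elim (x≢ (s≤s⁻¹ i≤k) (sym e))
    injective′ {suc i} {suc j} i≤k j≤k e = cong suc (injective c (s≤s⁻¹ i≤k) (s≤s⁻¹ j≤k) e)

    edge′ : i < suc k → Adj G ((x ◃ p) i) ((x ◃ p) (suc i))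
    edge′ {zero}  _   = x∼p₀
    edge′ {suc i} i<k = edge c (s≤s⁻¹ i<k)

    chordless′ : i ≤ suc k → j ≤ suc k → Adj G ((x ◃ p) i) ((x ◃ p) j) →
                 suc i ≡ j ⊎ suc j ≡ i
    chordless′ {zero}  {zero}  _   _   a = ⊥-elim (Adj-irrefl a)
    chordless′ {zero}  {suc j} _   j≤k a = inj₁ (cong suc (sym (only-head (s≤s⁻¹ j≤k) (inj₂ a))))
    chordless′ {suc i} {zero}  i≤k _   a =
      inj₂ (cong suc (sym (only-head (s≤s⁻¹ i≤k) (inj₂ (Adj-sym a)))))
    chordless′ {suc i} {suc j} i≤k j≤k a =
      Sum.map (cong suc) (cong suc) (chordless c (s≤s⁻¹ i≤k) (s≤s⁻¹ j≤k) a)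

  induced-P₃ : Adj G u w → Adj G w v → ¬ Adj G u v → u ≢ v →
               ChordlessPath 2 (u ◃ w ◃ λ _ → v)
  induced-P₃ uw wv u≁v u≢v =
    cons uw (λ { (s≤s z≤n) → [ u≢v , u≁v ]′ }) (cons wv (λ ()) single)

  ends-distinct : ChordlessPath (suc k) p → p 0 ≢ p (suc k)
  ends-distinct c e with injective c z≤n ≤-refl e
  ... | ()

  ends-nonadjacent : ChordlessPath (suc (suc k)) p → ¬ Adj G (p 0) (p (suc (suc k)))
  ends-nonadjacent c a with chordless c z≤n ≤-refl a
  ... | inj₁ ()
  ... | inj₂ ()

  length<n : ChordlessPath k p → k < n
  length<n {k} {p} c = injective⇒≤ {f = λ (i : Fin (suc k)) → p (toℕ i)}
    λ e → toℕ-injective (injective c (toℕ≤pred[n] _) (toℕ≤pred[n] _) e)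

  Convex′ : VSet G → Set
  Convex′ D = ∀ {k p} → ChordlessPath k p → D (p 0) → D (p k) → ∀ {t} → t ≤ k → D (p t)

  convex⇒convex′ : Convex G D → Convex′ D
  convex⇒convex′ {D} convex {k} {p} c d₀ dₖ {t} t≤k =
    subst (D ∘ p) (toℕ-fromℕ< (s≤s t≤k)) (convex _ _ d₀ dₖ k (p ∘ toℕ) path (fromℕ< (s≤s t≤k)))
    where
    path : IsChordlessPath G (p 0) (p k) k (p ∘ toℕ)
    path = refl , cong p (toℕ-fromℕ k)
         , (λ i j e → toℕ-injective (injective c (toℕ≤pred[n] i) (toℕ≤pred[n] j) e))
         , λ i j → mk⇔ (chordless c (toℕ≤pred[n] i) (toℕ≤pred[n] j))
                       (consecutive c (toℕ≤pred[n] i) (toℕ≤pred[n] j))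

  clamp : ∀ k → ℕ → Fin (suc k)
  clamp k       zero    = Fin.zero
  clamp zero    (suc t) = Fin.zero
  clamp (suc k) (suc t) = Fin.suc (clamp k t)

  toℕ-clamp : t ≤ k → toℕ (clamp k t) ≡ t
  toℕ-clamp {zero}  _         = refl
  toℕ-clamp {suc t} (s≤s t≤k) = cong suc (toℕ-clamp t≤k)

  clamp-toℕ : (i : Fin (suc k)) → clamp k (toℕ i) ≡ i
  clamp-toℕ {k}     Fin.zero    = refl
  clamp-toℕ {suc k} (Fin.suc i) = cong Fin.suc (clamp-toℕ i)

  convex′⇒convex : Convex′ D → Convex G D
  convex′⇒convex {D} convex u v du dv k p (start , end , inj , adj⇔) i =
    subst (D ∘ p) (clamp-toℕ i)
      (convex path (subst D (sym start) du) (subst D (sym end′) dv) (toℕ≤pred[n] i))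
    where
    pₙ : ℕ → V G
    pₙ = p ∘ clamp k

    end′ : pₙ k ≡ v
    end′ = trans (cong p (toℕ-injective (trans (toℕ-clamp ≤-refl) (sym (toℕ-fromℕ k))))) end

    path : ChordlessPath k pₙ
    path = record
      { injective = λ i≤k j≤k e →
          trans (sym (toℕ-clamp i≤k)) (trans (cong toℕ (inj _ _ e)) (toℕ-clamp j≤k))
      ; edge      = λ {i} i<k → Equivalence.from (adj⇔ _ _)
          (inj₁ (trans (cong suc (toℕ-clamp (<⇒≤ i<k))) (sym (toℕ-clamp i<k))))
      ; chordless = λ i≤k j≤k a →
          subst₂ (λ i j → suc i ≡ j ⊎ suc j ≡ i) (toℕ-clamp i≤k) (toℕ-clamp j≤k)
            (Equivalence.to (adj⇔ _ _) a)
      }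

  -- Walks all of whose vertices except possibly the first lie in W.
  Step : VSet G → V G → V G → Set
  Step W x y = Adj G x y × W y

  Reach : VSet G → V G → V G → Set
  Reach W = Star (Step W)

  reach-mono : W ⊆ X → Reach W u v → Reach X u v
  reach-mono W⊆X = Star.map (map₂ W⊆X)

  reach-end : W u → Reach W u v → W v
  reach-end wu ε              = wu
  reach-end wu ((_ , wy) ◅ r) = reach-end wy r

  reverse : W u → Reach W u v → Reach W v u
  reverse wu ε               = ε
  reverse wu ((uy , wy) ◅ r) = reverse wy r ◅◅ Star.return (Adj-sym uy , wu)

  walk⇒reach : ∀ k (p : Fin (suc k) → V G) → IsWalk G u v k p → Reach (λ _ → ⊤) u v
  walk⇒reach zero    p (refl , refl , _)     = ε
  walk⇒reach (suc k) p (refl , end , steps) =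
    (steps Fin.zero , tt) ◅ walk⇒reach k (p ∘ Fin.suc) (refl , end , steps ∘ Fin.suc)

  reach⇒walk : Reach W u v →
    ∃ λ k → Σ (Fin (suc k) → V G) λ p → IsWalk G u v k p × (∀ i → Reach W u (p i))
  reach⇒walk ε = 0 , (λ _ → _) , (refl , refl , λ ()) , λ _ → ε
  reach⇒walk {u = u} (s@(u∼y , _) ◅ r) with reach⇒walk r
  ... | k , p , (refl , end , steps) , reach =
    suc k , u Vector.∷ p , (refl , end , λ { Fin.zero → u∼y ; (Fin.suc i) → steps i })
    , λ { Fin.zero → ε ; (Fin.suc i) → s ◅ reach i }

  record ChordlessRoute (W : VSet G) (u v : V G) : Set where
    constructor route
    field
      length : ℕ
      vertex : ℕ → V G
      path   : ChordlessPath length vertex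
      start  : vertex 0 ≡ u
      end    : vertex length ≡ v
      within : t < length → W (vertex (suc t))

  attach-head : (∀ {t} → t ≤ k → W (q t)) → ChordlessPath k q → q k ≡ v →
                (∀ {t} → t < k → ¬ Related x (q (suc t))) →
                (∀ {t} → t ≤ k → ¬ Related x (q t)) ⊎ ChordlessRoute W x v
  attach-head {q = q} {x = x} inW c end fresh with related? x (q 0)
  ... | yes (inj₁ x≡q₀) = inj₂ (route _ _ c (sym x≡q₀) end inW)
  ... | yes (inj₂ x∼q₀) = inj₂ (route _ _ (cons x∼q₀ fresh c) refl end (inW ∘ s≤s⁻¹))
  ... | no ¬r           = inj₁ λ { {zero} _ → ¬r ; {suc t} t<k → fresh t<k }

  -- Put x in front of q, cutting q at the last vertex equal or adjacent to x.
  attach : (∀ {t} → t ≤ k → W (q t)) → ChordlessPath k q → q k ≡ v →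
           (∀ {t} → t ≤ k → ¬ Related x (q t)) ⊎ ChordlessRoute W x v
  attach {k = zero}  inW c end = attach-head inW c end λ ()
  attach {k = suc k} inW c end with attach (inW ∘ s≤s) (tail c) end
  ... | inj₂ r     = inj₂ r
  ... | inj₁ fresh = attach-head inW c end (fresh ∘ s≤s⁻¹)

  extend-route : Adj G x y → W y → ChordlessRoute W y v → ChordlessRoute W x v
  extend-route {x} {W = W} x∼y wy (route k q c refl end within) =
    [ (λ unrelated → ⊥-elim (unrelated z≤n (inj₂ x∼y))) , id ]′ (attach inW c end)
    where
    inW : t ≤ k → W (q t)
    inW {zero}  _   = wy
    inW {suc t} t<k = within t<k

  chordless-route : Reach W u v → ChordlessRoute W u v
  chordless-route ε                = route 0 _ single refl refl λ ()
  chordless-route ((x∼y , wy) ◅ r) = extend-route x∼y wy (chordless-route r)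

  Reach≤ : ℕ → VSet G → V G → V G → Set
  Reach≤ zero    W u v = u ≡ v
  Reach≤ (suc m) W u v = u ≡ v ⊎ ∃ λ w → Step W u w × Reach≤ m W w v

  reach≤? : Decidable W → ∀ m u v → Dec (Reach≤ m W u v)
  reach≤? W? zero    u v = u ≟ v
  reach≤? W? (suc m) u v =
    u ≟ v ⊎-dec any? λ w → (adj? u w ×-dec W? w) ×-dec reach≤? W? m w v

  reach≤⇒reach : Reach≤ m W u v → Reach W u v
  reach≤⇒reach {zero}  refl              = ε
  reach≤⇒reach {suc m} (inj₁ refl)       = ε
  reach≤⇒reach {suc m} (inj₂ (_ , s , r)) = s ◅ reach≤⇒reach r

  reach≤-mono : k ≤ m → Reach≤ k W u v → Reach≤ m W u v
  reach≤-mono {m = zero}  z≤n       e                  = e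
  reach≤-mono {m = suc m} z≤n       e                  = inj₁ e
  reach≤-mono             (s≤s k≤m) (inj₁ e)           = inj₁ e
  reach≤-mono             (s≤s k≤m) (inj₂ (w , s , r)) = inj₂ (w , s , reach≤-mono k≤m r)

  path⇒reach≤ : ChordlessPath k p → (∀ {t} → t < k → W (p (suc t))) →
                Reach≤ k W (p 0) (p k)
  path⇒reach≤ {zero}  c inW = refl
  path⇒reach≤ {suc k} c inW =
    inj₂ (_ , (edge c (s≤s z≤n) , inW (s≤s z≤n)) , path⇒reach≤ (tail c) (inW ∘ s≤s))

  reachable? : Decidable W → ∀ u v → Dec (Reach W u v)
  reachable? {W} W? u v = map′ reach≤⇒reach reach⇒reach≤ (reach≤? W? n u v)
    where
    reach⇒reach≤ : Reach W u v → Reach≤ n W u v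
    reach⇒reach≤ r with chordless-route r
    ... | route k p c refl refl within =
      reach≤-mono (<⇒≤ (length<n c)) (path⇒reach≤ c within)

  ⊆-cl : X ⊆ cl G X
  ⊆-cl xv _ _ X⊆C = X⊆C _ xv

  cl-convex : Convex′ (cl G X)
  cl-convex c cl₀ clₖ t≤k C convex X⊆C =
    convex⇒convex′ convex c (cl₀ C convex X⊆C) (clₖ C convex X⊆C) t≤k

  ⁅⁆-convex : Convex′ (⟦_⟧ G ⁅ x ⁆)
  ⁅⁆-convex {k = zero}  _         x₀ _  z≤n = x₀
  ⁅⁆-convex {x} {k = suc k} c x₀ xₖ _ =
    ⊥-elim (ends-distinct c (trans (x∈⁅y⁆⇒x≡y x x₀) (sym (x∈⁅y⁆⇒x≡y x xₖ))))

  path-in-cl : ChordlessPath k p → X (p 0) → X (p k) → t ≤ k → cl G X (p t)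
  path-in-cl c x₀ xₖ = cl-convex c (⊆-cl x₀) (⊆-cl xₖ)

  common-neighbour-in-cl : X u → X v → u ≢ v → ¬ Adj G u v → Adj G u w → Adj G w v → cl G X w
  common-neighbour-in-cl xu xv u≢v u≁v uw wv = path-in-cl (induced-P₃ uw wv u≁v u≢v) xu xv (s≤s z≤n)

  -- The second vertex of a chordless u–v path lies in every convex set containing u and v.
  convex-meets-walk : Convex′ C → C u → C v → u ≢ v → ¬ Adj G u v →
                      Reach (D ∪ ｛_｝ G v) u v → ∃ λ w → D w × Adj G u w × C w
  convex-meets-walk convex cu cv u≢v u≁v r with chordless-route r
  ... | route zero          p c refl refl _      = ⊥-elim (u≢v refl)
  ... | route (suc zero)    p c refl refl _      = ⊥-elim (u≁v (edge c (s≤s z≤n)))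
  ... | route (suc (suc k)) p c refl refl within with within (s≤s z≤n)
  ...   | inj₁ dp₁ = p 1 , dp₁ , edge c (s≤s z≤n) , convex c cu cv (s≤s z≤n)
  ...   | inj₂ p₁≡v with injective c (s≤s z≤n) ≤-refl p₁≡v
  ...     | ()

  cl-meets-walk : ∀ X → X u → X v → u ≢ v → ¬ Adj G u v → Reach (D ∪ ｛_｝ G v) u v →
                  ∃ λ w → D w × Adj G u w × cl G X w
  cl-meets-walk X xu xv = convex-meets-walk cl-convex (⊆-cl xu) (⊆-cl xv)

  NoDetour : VSet G → Set
  NoDetour D = ∀ {m p} → ChordlessPath (2 + m) p → D (p 0) → D (p (2 + m)) →
               ¬ D (p 1) → ¬ D (p (1 + m)) → ⊥

  no-detour⇒convex : Decidable D → NoDetour D → Convex′ D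
  no-detour⇒convex {D} D? no-detour c = convex _ c
    where
    convex : ∀ k {p} → ChordlessPath k p → D (p 0) → D (p k) → ∀ {t} → t ≤ k → D (p t)
    convex _             c d₀ dₖ {zero}        _        = d₀
    convex (suc zero)    c d₀ dₖ {suc zero}    _        = dₖ
    convex (suc zero)    c d₀ dₖ {suc (suc t)} (s≤s ())
    convex (suc (suc m)) {p} c d₀ dₖ {suc t} t≤k =
      [ (λ d₁ → convex (suc m) (tail c) d₁ dₖ (s≤s⁻¹ t≤k))
      , (λ ¬d₁ → ⊥-elim ([ (λ dₘ → ¬d₁ (convex (suc m) (init c) d₀ dₘ (s≤s z≤n)))
                         , no-detour c d₀ dₖ ¬d₁
                         ]′ (toSum (D? (p (1 + m))))))
      ]′ (toSum (D? (p 1)))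

  N? : Decidable X → Decidable (N G X)
  N? X? u = ¬? (X? u) ×-dec any? λ x → X? x ×-dec adj? u x

  nonadjacent-pair : Decidable X → ¬ Clique G X → ∃₂ λ u v → X u × X v × u ≢ v × ¬ Adj G u v
  nonadjacent-pair X? ¬clique
    with any? (λ u → any? λ v → X? u ×-dec X? v ×-dec ¬? (u ≟ v) ×-dec ¬? (adj? u v))
  ... | yes (u , v , pair) = u , v , pair
  ... | no none = ⊥-elim (¬clique λ u v xu xv u≢v →
          decidable-stable (adj? u v) λ u≁v → none (u , v , xu , xv , u≢v , u≁v))

  clique-⊆ : X ⊆ Y → Clique G Y → Clique G X
  clique-⊆ X⊆Y clique u v xu xv = clique u v (X⊆Y xu) (X⊆Y xv)

  N-∪-comm : N G (P ∪ Q) ⊆ N G (Q ∪ P)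
  N-∪-comm (¬pq , x , pqx , ux) = ¬pq ∘ Sum.swap , x , Sum.swap pqx , ux

  linked-sym : Linked G P Q → Linked G Q P
  linked-sym (x , y , px , qy , xy) = y , x , qy , px , Adj-sym xy

  ⊆-/ : P ⊆ _/_ G P Q
  ⊆-/ {x = v} pv = v , ⊆-cl (inj₂ refl) , pv

  /⊆σ : _/_ G P Q ⊆ σ G P Q
  /⊆σ = ⊆-cl ∘ inj₁

  σ⊆⇒convex : σ G P Q ⊆ P → Convex′ P
  σ⊆⇒convex σ⊆P c p₀ pₖ t≤k = σ⊆P (cl-convex c (/⊆σ (⊆-/ p₀)) (/⊆σ (⊆-/ pₖ)) t≤k)

  module _ (conn : Connected G) where

    convex-reach : Convex′ D → D u → D v → Reach D u v
    convex-reach {u = u} {v = v} convex du dv with conn u v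
    ... | k , p , walk with chordless-route (walk⇒reach k p walk)
    ...   | route _ q c refl refl _ = reach≤⇒reach (path⇒reach≤ c (convex c du dv))

    walk-through : Convex′ P → Adj G s d → P d → P d′ → Adj G d′ v → Reach (P ∪ ｛_｝ G v) s v
    walk-through convex sd pd pd′ d′v =
      (sd , inj₁ pd) ◅ reach-mono inj₁ (convex-reach convex pd pd′) ◅◅ Star.return (d′v , inj₂ refl)

    -- Otherwise a chordless path from v through P to Q shows v ∈ P / Q.
    adjacent-across : Decidable Q → σ G P Q ⊆ P → Linked G P Q →
                      ¬ P v → ¬ Q v → Adj G v x → P x → ∃ λ b → Q b × Adj G v b
    adjacent-across {Q = Q} {v = v} Q? σ⊆P (a , b , pa , qb , ab) ¬pv ¬qv vx px
      with any? (λ b → Q? b ×-dec adj? v b)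
    ... | yes found = found
    ... | no none
      with cl-meets-walk (Q ∪ ｛_｝ G v) (inj₂ refl) (inj₁ qb)
             (λ { refl → ¬qv qb }) (λ vb → none (b , qb , vb))
             (walk-through (σ⊆⇒convex σ⊆P) vx px pa ab)
    ...   | w , pw , _ , clw = ⊥-elim (¬pv (σ⊆P (/⊆σ (w , clw , pw))))

  record Admissible (P Q X : VSet G) : Set where
    field
      avoids : X v → ¬ (P ∪ Q) v
      closed : X y → ¬ N[_] G (P ∪ Q) y → Adj G y z → ¬ (P ∪ Q) z → X z
      clique : Clique G (X ∩ N G (P ∪ Q))

  admissible-swap : Admissible P Q X → Admissible Q P X
  admissible-swap adm = record
    { avoids = λ xv → avoids xv ∘ Sum.swap
    ; closed = λ xy far-y yz ¬z →
        closed xy (far-y ∘ Sum.map N-∪-comm Sum.swap) yz (¬z ∘ Sum.swap)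
    ; clique = clique-⊆ (map₂ N-∪-comm) clique
    }
    where open Admissible adm


module Classes (G : Graph) (A B : Subset (Graph.n G)) where

  open GraphTheory G

  private
    𝐀 𝐁 AB : VSet G
    𝐀 = ⟦_⟧ G A
    𝐁 = ⟦_⟧ G B
    AB = 𝐀 ∪ 𝐁

    AB? : Decidable AB
    AB? v = v ∈? A ⊎-dec v ∈? B

    variable
      y z : V G
      C K : Subset (Graph.n G)

  Far : VSet G
  Far v = ¬ N[_] G AB v

  far? : Decidable Far
  far? v = ¬? (N? AB? v ⊎-dec AB? v)

  component : Far y → ∃ λ C → IsComponent G 𝐀 𝐁 C × y ∈ C
  component {y} far-y = Cy , (( y , y∈Cy) , far , walks , closed) , y∈Cy
    where
    reach? : Decidable (Reach Far y)
    reach? = reachable? far? y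

    Cy : Subset (Graph.n G)
    Cy = subset reach?

    y∈Cy : y ∈ Cy
    y∈Cy = ∈-subset⁺ reach? ε

    far : ∀ s → s ∈ Cy → Far s
    far s s∈Cy = reach-end far-y (∈-subset⁻ reach? s∈Cy)

    walks : ∀ s t → s ∈ Cy → t ∈ Cy →
            ∃ λ k → Σ (Fin (suc k) → V G) λ p → IsWalk G s t k p × (∀ i → p i ∈ Cy)
    walks s t s∈Cy t∈Cy
      with reach⇒walk (reverse far-y (∈-subset⁻ reach? s∈Cy) ◅◅ ∈-subset⁻ reach? t∈Cy)
    ... | k , p , walk , reach =
      k , p , walk , λ i → ∈-subset⁺ reach? (∈-subset⁻ reach? s∈Cy ◅◅ reach i)

    closed : ∀ s w → s ∈ Cy → Far w → Adj G s w → w ∈ Cy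
    closed s w s∈Cy far-w sw =
      ∈-subset⁺ reach? (∈-subset⁻ reach? s∈Cy ◅◅ Star.return (sw , far-w))

  N[]-step : y ∈ K → Adj G y z → N[_] G (⟦_⟧ G K) z
  N[]-step {K = K} {z = z} y∈K yz with z ∈? K
  ... | yes z∈K = inj₂ z∈K
  ... | no z∉K  = inj₁ (z∉K , _ , y∈K , Adj-sym yz)

  absorb : IsComponent G 𝐀 𝐁 C → N[_] G (⟦_⟧ G C) y → Far y → y ∈ C
  absorb _                   (inj₂ y∈C)              _     = y∈C
  absorb (_ , _ , _ , closed) (inj₁ (_ , s , s∈C , ys)) far-y = closed s _ s∈C far-y (Adj-sym ys)

  class-avoids : IsClass G 𝐀 𝐁 K → y ∈ K → ¬ AB y
  class-avoids (_ , _ , iff) y∈K = proj₁ (Equivalence.to (iff _) y∈K)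

  CommonSequence : V G → V G → Set
  CommonSequence u v = ∃ λ k → Σ (Fin (suc k) → Subset (Graph.n G)) λ Ss →
    IsIntersectingSeq G 𝐀 𝐁 k Ss × BelongsTo G k Ss u × BelongsTo G k Ss v

  class-closed : IsClass G 𝐀 𝐁 K → y ∈ K → Far y → Adj G y z → ¬ AB z → z ∈ K
  class-closed {y = y} {z = z} (w , ¬ABw , iff) y∈K far-y yz ¬ABz =
    Equivalence.from (iff z)
      (¬ABz , ¬ABw , inj₂ (move (proj₂ (proj₂ (Equivalence.to (iff y) y∈K)))))
    where
    move : y ≡ w ⊎ CommonSequence y w → CommonSequence z w
    move (inj₁ refl) with component far-y
    ... | C , isC , y∈C =
      0 , (λ _ → C) , ((λ _ → isC) , λ ()) , (Fin.zero , N[]-step y∈C yz) , (Fin.zero , inj₂ y∈C)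
    move (inj₂ (k , Ss , seq , (i , y∈N[Sᵢ]) , w∈)) =
      k , Ss , seq , (i , N[]-step (absorb (proj₁ seq i) y∈N[Sᵢ] far-y) yz) , w∈

  ⋃-admissible : ∀ {𝒳} → All (IsClass G 𝐀 𝐁) 𝒳 → Clique G (⋃ G 𝒳 ∩ N G AB) →
                 Admissible 𝐀 𝐁 (⋃ G 𝒳)
  ⋃-admissible classes clique = record
    { avoids = λ y∈⋃ → let K , K∈𝒳 , y∈K = find y∈⋃ in
                 class-avoids (All.lookup classes K∈𝒳) y∈K
    ; closed = λ y∈⋃ far-y yz ¬ABz → let K , K∈𝒳 , y∈K = find y∈⋃ in
                 lose K∈𝒳 (class-closed (All.lookup classes K∈𝒳) y∈K far-y yz ¬ABz)
    ; clique = clique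
    }


module SaturatedPair (G : Graph) (conn : Connected G) (A B : Subset (Graph.n G))
  (linked : Linked G (⟦_⟧ G A) (⟦_⟧ G B))
  (σ⊆A : σ G (⟦_⟧ G A) (⟦_⟧ G B) ⊆ ⟦_⟧ G A)
  (σ⊆B : σ G (⟦_⟧ G B) (⟦_⟧ G A) ⊆ ⟦_⟧ G B)
  (∂-not-clique : ¬ Clique G (N G (⟦_⟧ G A ∪ ⟦_⟧ G B)))
  where

  open GraphTheory G

  private
    𝐀 𝐁 ∂ : VSet G
    𝐀 = ⟦_⟧ G A
    𝐁 = ⟦_⟧ G B
    ∂ = N G (𝐀 ∪ 𝐁)

    variable
      a m q s t u x y z : V G

  clA : V G → VSet G
  clA y = cl G (𝐀 ∪ ｛_｝ G y)

  ∂? : Decidable ∂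
  ∂? = N? λ v → v ∈? A ⊎-dec v ∈? B

  ∂⇒¬A : ∂ y → ¬ 𝐀 y
  ∂⇒¬A (¬AB , _) = ¬AB ∘ inj₁

  ∂⇒¬B : ∂ y → ¬ 𝐁 y
  ∂⇒¬B (¬AB , _) = ¬AB ∘ inj₂

  ∂⇒≢A : ∂ y → 𝐀 x → y ≢ x
  ∂⇒≢A ∂y xA refl = ∂⇒¬A ∂y xA

  A-convex : Convex′ 𝐀
  A-convex = σ⊆⇒convex σ⊆A

  B-convex : Convex′ 𝐁
  B-convex = σ⊆⇒convex σ⊆B

  clA-avoids-B : ¬ 𝐁 y → clA y z → ¬ 𝐁 z
  clA-avoids-B ¬By clz Bz = ¬By (σ⊆B (/⊆σ (_ , clz , Bz)))

  ∂-adjacent-A : ∂ y → ∃ λ a → 𝐀 a × Adj G y a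
  ∂-adjacent-A (_   , x , inj₁ xA , yx) = x , xA , yx
  ∂-adjacent-A (¬AB , x , inj₂ xB , yx) =
    adjacent-across conn (_∈? A) σ⊆B (linked-sym linked) (¬AB ∘ inj₂) (¬AB ∘ inj₁) yx xB

  ∂-adjacent-B : ∂ y → ∃ λ b → 𝐁 b × Adj G y b
  ∂-adjacent-B (_   , x , inj₂ xB , yx) = x , xB , yx
  ∂-adjacent-B (¬AB , x , inj₁ xA , yx) =
    adjacent-across conn (_∈? B) σ⊆A linked (¬AB ∘ inj₁) (¬AB ∘ inj₂) yx xA

  via-A : ∂ s → ∂ t → Reach (𝐀 ∪ ｛_｝ G t) s t
  via-A ∂s ∂t with ∂-adjacent-A ∂s | ∂-adjacent-A ∂t
  ... | a , aA , sa | a′ , a′A , ta′ = walk-through conn A-convex sa aA a′A (Adj-sym ta′)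

  via-B : ∂ s → ∂ t → Reach (𝐁 ∪ ｛_｝ G t) s t
  via-B ∂s ∂t with ∂-adjacent-B ∂s | ∂-adjacent-B ∂t
  ... | b , bB , sb | b′ , b′B , tb′ = walk-through conn B-convex sb bB b′B (Adj-sym tb′)

  nonadjacent-share-A-neighbours : ∂ u → ∂ m → ¬ Adj G u m → 𝐀 a → Adj G m a → Adj G u a
  nonadjacent-share-A-neighbours ∂u ∂m u≁m aA ma = decidable-stable (adj? _ _) λ u≁a →
    let w , w∈B+m , uw , clw = cl-meets-walk (𝐀 ∪ ｛_｝ G _) (inj₂ refl) (inj₁ aA)
                                 (∂⇒≢A ∂u aA) u≁a
                                 (reach-mono inj₁ (via-B ∂u ∂m) ◅◅ Star.return (ma , inj₂ refl))
    in [ clA-avoids-B (∂⇒¬B ∂u) clw , (λ w≡m → u≁m (subst (Adj G _) w≡m uw)) ]′ w∈B+m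

  clA∩∂-clique : ¬ 𝐁 y → Clique G (clA y ∩ ∂)
  clA∩∂-clique ¬By s t (cls , ∂s) (clt , ∂t) s≢t = decidable-stable (adj? s t) λ s≁t →
    let w , wB , _ , clw = convex-meets-walk cl-convex cls clt s≢t s≁t (via-B ∂s ∂t)
    in clA-avoids-B ¬By clw wB

  nonadjacent-pair-mfs : ∂ y → ∂ q → y ≢ q → ¬ Adj G y q → MFS G 𝐀 𝐁 (⁅ y ⁆ ∪ˢ ⁅ q ⁆)
  nonadjacent-pair-mfs {y} {q} ∂y ∂q y≢q y≁q =
    (outside , meets (via-A ∂y ∂q) , meets (via-B ∂y ∂q)) , minimal
    where
    Z : Subset (Graph.n G)
    Z = ⁅ y ⁆ ∪ˢ ⁅ q ⁆

    outside : ∀ z → z ∈ Z → ¬ (𝐀 ∪ 𝐁) z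
    outside _ z∈Z with ∈⁅⁆∪⁅⁆ z∈Z
    ... | inj₁ refl = proj₁ ∂y
    ... | inj₂ refl = proj₁ ∂q

    meets : ∀ {D} → Reach (D ∪ ｛_｝ G q) y q → Meets G (cl G (⟦_⟧ G Z)) D
    meets r =
      let w , dw , _ , clw = cl-meets-walk (⟦_⟧ G Z) (x∈p∪q⁺ (inj₁ (x∈⁅x⁆ y)))
                               (x∈p∪q⁺ (inj₂ (x∈⁅x⁆ q))) y≢q y≁q r
      in w , clw , dw

    only : ∀ {Z′ s} → (∀ z → z ∈ Z′ → z ≡ s) → Meets G (cl G (⟦_⟧ G Z′)) 𝐀 → 𝐀 s
    only {s = s} Z′≡s (a , cla , aA) =
      subst 𝐀 (x∈⁅y⁆⇒x≡y s (cla ⁅ s ⁆ (convex′⇒convex ⁅⁆-convex)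
                              λ z z∈Z′ → subst (_∈ ⁅ s ⁆) (sym (Z′≡s z z∈Z′)) (x∈⁅x⁆ s)))
            aA

    minimal : ∀ Z′ → Forbidden G 𝐀 𝐁 Z′ → (∀ w → w ∈ Z′ → w ∈ Z) → ∀ w → w ∈ Z → w ∈ Z′
    minimal Z′ (_ , meetsA , _) Z′⊆Z w w∈Z with ∈⁅⁆∪⁅⁆ w∈Z
    ... | inj₁ refl = decidable-stable (y ∈? Z′) λ y∉Z′ → ∂⇒¬A ∂q (only (λ z z∈Z′ →
          [ (λ z≡y → ⊥-elim (y∉Z′ (subst (_∈ Z′) z≡y z∈Z′))) , id ]′ (∈⁅⁆∪⁅⁆ (Z′⊆Z z z∈Z′))) meetsA)
    ... | inj₂ refl = decidable-stable (q ∈? Z′) λ q∉Z′ → ∂⇒¬A ∂y (only (λ z z∈Z′ →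
          [ id , (λ z≡q → ⊥-elim (q∉Z′ (subst (_∈ Z′) z≡q z∈Z′))) ]′ (∈⁅⁆∪⁅⁆ (Z′⊆Z z z∈Z′))) meetsA)

  clA∩clA⊆A : ∂ y → ∂ q → y ≢ q → ¬ Adj G y q → clA y z → clA q z → 𝐀 z
  clA∩clA⊆A {y} {q} {z} ∂y ∂q y≢q y≁q cly clq =
    σ⊆A (⊆-cl (inj₂ (_ , nonadjacent-pair-mfs ∂y ∂q y≢q y≁q , λ w w∈Z →
      [ (λ w≡y → subst (λ r → clA r z) (sym w≡y) cly)
      , (λ w≡q → subst (λ r → clA r z) (sym w≡q) clq)
      ]′ (∈⁅⁆∪⁅⁆ w∈Z))))

  ∂-neighbour-in-clA : ∂ y → ∂ s → 𝐀 x → ¬ Adj G y x → Adj G s x → clA y s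
  ∂-neighbour-in-clA {y} {s} ∂y ∂s xA y≁x sx =
    common-neighbour-in-cl (inj₂ refl) (inj₁ xA) (∂⇒≢A ∂y xA) y≁x ys sx
    where
    ys : Adj G y s
    ys = decidable-stable (adj? y s) λ y≁s →
      y≁x (nonadjacent-share-A-neighbours ∂y ∂s y≁s xA sx)

  ∂-neighbours-clique : ∂ y → 𝐀 x → ¬ Adj G y x → Clique G (∂ ∩ λ s → Adj G s x)
  ∂-neighbours-clique ∂y xA y≁x s t (∂s , sx) (∂t , tx) =
    clA∩∂-clique (∂⇒¬B ∂y) s t (∂-neighbour-in-clA ∂y ∂s xA y≁x sx , ∂s)
                               (∂-neighbour-in-clA ∂y ∂t xA y≁x tx , ∂t)

  -- If y misses x, take non-adjacent m₁, m₂ ∈ ∂; they see x alike. If both see x, this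
  -- contradicts ∂-neighbours-clique; if neither does, q ∈ clA m₁ ∩ clA m₂ ⊆ A.
  ∂-same-A-neighbours : ∂ y → ∂ q → 𝐀 x → Adj G q x → Adj G y x
  ∂-same-A-neighbours {y} {q} {x} ∂y ∂q xA qx = decidable-stable (adj? y x) λ y≁x →
    let m₁ , m₂ , ∂m₁ , ∂m₂ , m₁≢m₂ , m₁≁m₂ = nonadjacent-pair ∂? ∂-not-clique
        share = nonadjacent-share-A-neighbours
    in [ (λ m₁x → m₁≁m₂ (∂-neighbours-clique ∂y xA y≁x m₁ m₂
                           (∂m₁ , m₁x) (∂m₂ , share ∂m₂ ∂m₁ (m₁≁m₂ ∘ Adj-sym) xA m₁x) m₁≢m₂))
       , (λ m₁≁x → let m₂≁x = m₁≁x ∘ share ∂m₁ ∂m₂ m₁≁m₂ xA in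
            ∂⇒¬A ∂q (clA∩clA⊆A ∂m₁ ∂m₂ m₁≢m₂ m₁≁m₂ (∂-neighbour-in-clA ∂m₁ ∂q xA m₁≁x qx)
                                                    (∂-neighbour-in-clA ∂m₂ ∂q xA m₂≁x qx)))
       ]′ (toSum (adj? m₁ x))

  clA-neighbour-of-A : ∂ y → 𝐀 a → clA y q → ¬ 𝐀 q → Adj G q a → Adj G y a
  clA-neighbour-of-A ∂y aA clq ¬Aq qa =
    ∂-same-A-neighbours ∂y ([ ¬Aq , clA-avoids-B (∂⇒¬B ∂y) clq ]′ , _ , inj₁ aA , qa) aA qa

  A∪X-convex : ∀ {X} → Decidable X → Admissible 𝐀 𝐁 X → Convex G (𝐀 ∪ X)
  A∪X-convex {X} X? adm =
    convex′⇒convex (no-detour⇒convex (λ v → v ∈? A ⊎-dec X? v) no-detour)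
    where
    open Admissible adm

    stuck : X y → ¬ ∂ y → Adj G y z → ¬ (𝐀 ∪ X) z → ⊥
    stuck xy ¬∂y yz ¬Dz = ¬Dz (inj₂ (closed xy [ ¬∂y , avoids xy ]′ yz
      [ ¬Dz ∘ inj₁ , (λ zB → ¬∂y (avoids xy , _ , inj₂ zB , yz)) ]′))

    end-kind : (𝐀 ∪ X) y → Adj G y z → ¬ (𝐀 ∪ X) z → 𝐀 y ⊎ (X y × ∂ y)
    end-kind (inj₁ yA) _  _   = inj₁ yA
    end-kind {y} (inj₂ xy) yz ¬Dz with ∂? y
    ... | yes ∂y = inj₂ (xy , ∂y)
    ... | no ¬∂y = ⊥-elim (stuck xy ¬∂y yz ¬Dz)

    no-detour : NoDetour (𝐀 ∪ X)
    no-detour c d₀ dₖ ¬d₁ ¬dₘ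
      with end-kind d₀ (edge c (s≤s z≤n)) ¬d₁ | end-kind dₖ (Adj-sym (edge c ≤-refl)) ¬dₘ
    ... | inj₁ a₀ | inj₁ aₖ = ¬d₁ (inj₁ (A-convex c a₀ aₖ (s≤s z≤n)))
    ... | inj₁ a₀ | inj₂ (_ , ∂ₖ) =
      ends-nonadjacent c (Adj-sym (clA-neighbour-of-A ∂ₖ a₀
        (path-in-cl c (inj₁ a₀) (inj₂ refl) (s≤s z≤n)) (¬d₁ ∘ inj₁) (Adj-sym (edge c (s≤s z≤n)))))
    ... | inj₂ (_ , ∂₀) | inj₁ aₖ =
      ends-nonadjacent c (clA-neighbour-of-A ∂₀ aₖ
        (path-in-cl c (inj₂ refl) (inj₁ aₖ) (m≤n⇒m≤1+n ≤-refl)) (¬dₘ ∘ inj₁) (edge c ≤-refl))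
    ... | inj₂ (x₀ , ∂₀) | inj₂ (xₖ , ∂ₖ) =
      ends-nonadjacent c (clique _ _ (x₀ , ∂₀) (xₖ , ∂ₖ) (ends-distinct c))


lemma24 : (G : Graph) → Connected G →
    (A B : Subset (Graph.n G)) →
    Disjoint G (⟦_⟧ G A) (⟦_⟧ G B) →
    Linked G (⟦_⟧ G A) (⟦_⟧ G B) →
    Saturated G (⟦_⟧ G A) (⟦_⟧ G B) →
    ¬ Clique G (N G (_∪'_ G (⟦_⟧ G A) (⟦_⟧ G B))) →
    (𝒳 : List (Subset (Graph.n G))) →
    All (IsClass G (⟦_⟧ G A) (⟦_⟧ G B)) 𝒳 →
    Clique G (_∩'_ G (⋃ G 𝒳) (N G (_∪'_ G (⟦_⟧ G A) (⟦_⟧ G B)))) →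
    Convex G (_∪'_ G (⟦_⟧ G A) (⋃ G 𝒳)) × Convex G (_∪'_ G (⟦_⟧ G B) (⋃ G 𝒳))
lemma24 G conn A B _ linked (A≐S , B≐S) ∂-not-clique 𝒳 classes clique =
    SaturatedPair.A∪X-convex G conn A B linked σ⊆A σ⊆B ∂-not-clique X? admissible
  , SaturatedPair.A∪X-convex G conn B A (linked-sym linked) σ⊆B σ⊆A
      (∂-not-clique ∘ clique-⊆ N-∪-comm) X? (admissible-swap admissible)
  where
  open GraphTheory G

  σ⊆A : σ G (⟦_⟧ G A) (⟦_⟧ G B) ⊆ ⟦_⟧ G A
  σ⊆A σv = Equivalence.from (A≐S _) (0 , σv)

  σ⊆B : σ G (⟦_⟧ G B) (⟦_⟧ G A) ⊆ ⟦_⟧ G B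
  σ⊆B σv = Equivalence.from (B≐S _) (0 , σv)

  X? : Decidable (⋃ G 𝒳)
  X? v = Any.any? (v ∈?_) 𝒳

  admissible : Admissible (⟦_⟧ G A) (⟦_⟧ G B) (⋃ G 𝒳)
  admissible = Classes.⋃-admissible G A B classes clique
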